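{- Let $x$ be a non-ultimately periodic infinite word and let $u,v$ be factors of $x$ with $B(u)=A(v)$. Then $L(u)+L(v)\leq L(uv)\leq L(u)+L(v)+1$.
   Context: Write $x=x_0x_1\ldots$. For a factor $u$ of $x$, $A(u)=\min\{k: u=x_k\cdots x_{k+|u|-1}\}$ and $B(u)=A(u)+|u|$. A decomposition $u=v_1\cdots v_l$ ($l\geq1$, $v_i$ nonempty) is consecutive if $A(v_1)=A(u)$, $B(v_l)=B(u)$ and $B(v_i)=A(v_{i+1})$ for $1\leq i<l$. $L(u)$ is the maximal number of terms of a consecutive decomposition of $u$. -}

module Defs where

open import Data.Nat using (ℕ; zero; suc; _+_; _<_; _≤_; _≥_)
open import Data.List using (List; []; _∷_; length; concat)
open import Data.Product using (Σ; ∃; _×_; _,_)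
open import Data.Empty using (⊥)
open import Relation.Nullary using (¬_)
open import Relation.Binary.PropositionalEquality using (_≡_; _≢_)

slice : {S : Set} → (ℕ → S) → ℕ → ℕ → List S
slice x k zero    = []
slice x k (suc n) = x k ∷ slice x (suc k) n

OccursAt : {S : Set} → (ℕ → S) → List S → ℕ → Set
OccursAt x u k = u ≡ slice x k (length u)

Factor : {S : Set} → (ℕ → S) → List S → Set
Factor x u = ∃ λ k → OccursAt x u k

IsA : {S : Set} → (ℕ → S) → List S → ℕ → Set
IsA x u k = OccursAt x u k × (∀ j → j < k → ¬ OccursAt x u j)

UltimatelyPeriodic : {S : Set} → (ℕ → S) → Set
UltimatelyPeriodic x =
  Σ ℕ λ p → (p ≥ 1) × (Σ ℕ λ N → ∀ n → n ≥ N → x (n + p) ≡ x n)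

-- ConsecFrom x a b vs : for vs = v_1 ... v_l, all v_i nonempty,
-- A(v_1) = a, B(v_i) = A(v_{i+1}), and B(v_l) = b  (b = a when l = 0).
ConsecFrom : {S : Set} → (ℕ → S) → ℕ → ℕ → List (List S) → Set
ConsecFrom x a b []       = a ≡ b
ConsecFrom x a b (v ∷ vs) = (v ≢ []) × IsA x v a × ConsecFrom x (a + length v) b vs

Consecutive : {S : Set} → (ℕ → S) → List S → List (List S) → Set
Consecutive x u vs =
  (concat vs ≡ u) × (length vs ≥ 1) ×
  (Σ ℕ λ a → IsA x u a × ConsecFrom x a (a + length u) vs)

IsL : {S : Set} → (ℕ → S) → List S → ℕ → Set
IsL {S} x u n =
  (Σ (List (List S)) λ vs → Consecutive x u vs × length vs ≡ n) ×
  (∀ vs → Consecutive x u vs → length vs ≤ n)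

-- Concatenating maximal consecutive decompositions of u and of v gives a
-- consecutive decomposition of uv, whence L(u) + L(v) ≤ L(uv).  Conversely, cut a
-- maximal decomposition of uv at position B(u).  A term p q straddling the cut is
-- split: p is glued to the preceding term w (an earlier occurrence of w p would be
-- one of w) and q to the following term w' (an earlier occurrence of q w' would give
-- one of w' before B(u) + |q|); with no preceding (following) term, p = u (q = v)
-- is a term by itself.  At most one term is lost, whence L(uv) ≤ L(u) + L(v) + 1.
module Submission where

open import Defs
open import Data.Nat using (ℕ; suc; _+_; _≤_; z≤n; s≤s)
open import Data.Nat.Properties using (+-suc; +-assoc; +-comm; ≤-antisym; ≮⇒≥; +-monoˡ-<; ≤-refl; ≤-trans; +-mono-≤)
open import Data.List using (List; []; _∷_; length; _++_; concat)
open import Data.List.Properties using (++-assoc; ++-identityʳ; ++-conicalˡ; length-++; ∷-injective; concat-++)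
open import Data.Product using (_×_; _,_; Σ; proj₁; proj₂)
open import Data.Sum using (_⊎_; inj₁; inj₂)
open import Function using (_∘_)
open import Relation.Nullary using (¬_)
open import Relation.Binary.PropositionalEquality using (_≡_; _≢_; refl; sym; trans; cong; cong₂; subst)

++-≡-++-cases : {S : Set} (w r u v : List S) → w ++ r ≡ u ++ v →
  (Σ (List S) λ u′ → u ≡ w ++ u′ × r ≡ u′ ++ v) ⊎
  (Σ (List S) λ q → q ≢ [] × w ≡ u ++ q × v ≡ q ++ r)
++-≡-++-cases []      r u       v eq = inj₁ (u , refl , eq)
++-≡-++-cases (c ∷ w) r []      v eq = inj₂ (c ∷ w , (λ ()) , refl , sym eq)
++-≡-++-cases (c ∷ w) r (d ∷ u) v eq with ∷-injective eq
... | refl , eq′ with ++-≡-++-cases w r u v eq′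
...   | inj₁ (u′ , u≡ , r≡)      = inj₁ (u′ , cong (c ∷_) u≡ , r≡)
...   | inj₂ (q , q≢[] , w≡ , v≡) = inj₂ (q , q≢[] , cong (c ∷_) w≡ , v≡)

+-length-++ : {S : Set} (s : ℕ) (u v : List S) → s + length (u ++ v) ≡ s + length u + length v
+-length-++ s u v = trans (cong (s +_) (length-++ u)) (sym (+-assoc s (length u) (length v)))

module _ {S : Set} (x : ℕ → S) where

  occursAt-++⁻ : ∀ (p r : List S) j → OccursAt x (p ++ r) j →
                 OccursAt x p j × OccursAt x r (j + length p)
  occursAt-++⁻ []      r j o = refl , subst (OccursAt x r) (sym (+-comm j 0)) o
  occursAt-++⁻ (c ∷ p) r j o with ∷-injective o
  ... | c≡ , rest with occursAt-++⁻ p r (suc j) rest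
  ...   | op , or = cong₂ _∷_ c≡ op , subst (OccursAt x r) (sym (+-suc j (length p))) or

  occursAt-++⁺ : ∀ (p r : List S) j → OccursAt x p j → OccursAt x r (j + length p) →
                 OccursAt x (p ++ r) j
  occursAt-++⁺ []      r j op or = subst (OccursAt x r) (+-comm j 0) or
  occursAt-++⁺ (c ∷ p) r j op or with ∷-injective op
  ... | c≡ , rest = cong₂ _∷_ c≡
    (occursAt-++⁺ p r (suc j) rest (subst (OccursAt x r) (+-suc j (length p)) or))

  IsA-unique : ∀ {u a b} → IsA x u a → IsA x u b → a ≡ b
  IsA-unique (oa , a-min) (ob , b-min) =
    ≤-antisym (≮⇒≥ λ b<a → a-min _ b<a ob) (≮⇒≥ λ a<b → b-min _ a<b oa)

  IsA-++ʳ : ∀ {w} r {s} → IsA x w s → OccursAt x (w ++ r) s → IsA x (w ++ r) s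
  IsA-++ʳ {w} r (_ , w-min) o = o , λ j j<s oj → w-min j j<s (proj₁ (occursAt-++⁻ w r j oj))

  IsA-++ˡ : ∀ q {w s} → IsA x w (s + length q) → OccursAt x (q ++ w) s → IsA x (q ++ w) s
  IsA-++ˡ q {w} (_ , w-min) o =
    o , λ j j<s oj → w-min (j + length q) (+-monoˡ-< (length q) j<s) (proj₂ (occursAt-++⁻ q w j oj))

  ConsecFrom-++ : ∀ {a b c} us vs → ConsecFrom x a b us → ConsecFrom x b c vs →
                  ConsecFrom x a c (us ++ vs)
  ConsecFrom-++ []       vs refl         cv = cv
  ConsecFrom-++ (u ∷ us) vs (ne , Au , cu) cv = ne , Au , ConsecFrom-++ us vs cu cv

  Chain : ℕ → ℕ → List S → List (List S) → Set
  Chain s t u us = concat us ≡ u × ConsecFrom x s t us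

  -- The empty alternative covers a u-part swallowed by a term straddling the cut.
  ChainOrEmpty : ℕ → ℕ → List S → List (List S) → Set
  ChainOrEmpty s t u us = us ≡ [] ⊎ Chain s t u us

  Chain-++ : ∀ {s t e u v} us vs → Chain s t u us → Chain t e v vs → Chain s e (u ++ v) (us ++ vs)
  Chain-++ us vs (cat-u , cu) (cat-v , cv) =
    trans (sym (concat-++ us vs)) (cong₂ _++_ cat-u cat-v) , ConsecFrom-++ us vs cu cv

  Consecutive⇒Chain : ∀ {u a vs} → IsA x u a → Consecutive x u vs → Chain a (a + length u) u vs
  Consecutive⇒Chain {u} {vs = vs} Au (cat , _ , b , Bu , cf) =
    subst (λ t → Chain t (t + length u) u vs) (IsA-unique Bu Au) (cat , cf)

  Chain⇒Consecutive : ∀ {u a v vs} → IsA x u a → Chain a (a + length u) u (v ∷ vs) →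
                      Consecutive x u (v ∷ vs)
  Chain⇒Consecutive Au (cat , cf) = cat , s≤s z≤n , _ , Au , cf

  ChainOrEmpty-length≤L : ∀ {u a n us} → IsA x u a → IsL x u n →
                          ChainOrEmpty a (a + length u) u us → length us ≤ n
  ChainOrEmpty-length≤L {us = []}     _  _            _          = z≤n
  ChainOrEmpty-length≤L {us = _ ∷ _} Au (_ , maximal) (inj₂ ch) = maximal _ (Chain⇒Consecutive Au ch)

  absorb-prefix : ∀ {s c w} u′ us → w ≢ [] → IsA x w s → OccursAt x (w ++ u′) s →
                  c ≡ s + length (w ++ u′) → ChainOrEmpty (s + length w) c u′ us →
                  Σ (List (List S)) λ us′ → length us′ ≡ suc (length us) × Chain s c (w ++ u′) us′
  absorb-prefix {w = w} u′ [] w≢[] Aw o c≡ _ =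
    (w ++ u′) ∷ [] , refl ,
    ++-identityʳ (w ++ u′) , (w≢[] ∘ ++-conicalˡ w u′) , IsA-++ʳ u′ Aw o , sym c≡
  absorb-prefix {w = w} u′ (y ∷ ys) w≢[] Aw _ _ (inj₂ (cat , cf)) =
    w ∷ y ∷ ys , refl , cong (w ++_) cat , w≢[] , Aw , cf

  absorb-suffix : ∀ {c d e} q ws → q ≢ [] → IsA x (q ++ concat ws) c → d ≡ c + length q →
                  ConsecFrom x d e ws →
                  Σ (List (List S)) λ vs → length ws ≤ length vs × Chain c e (q ++ concat ws) vs
  absorb-suffix q [] q≢[] Aq d≡ d≡e =
    q ∷ [] , z≤n , refl , q≢[] , subst (λ z → IsA x z _) (++-identityʳ q) Aq , trans (sym d≡) d≡e
  absorb-suffix {c} {e = e} q (w ∷ ws) q≢[] Aqv refl (w≢[] , Aw , cf) =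
    (q ++ w) ∷ ws , ≤-refl , ++-assoc q w (concat ws) ,
    (q≢[] ∘ ++-conicalˡ q w) , IsA-++ˡ q Aw o ,
    subst (λ t → ConsecFrom x t e ws) (sym (+-length-++ c q w)) cf
    where
    o : OccursAt x (q ++ w) c
    o = proj₁ (occursAt-++⁻ (q ++ w) (concat ws) c
          (subst (λ z → OccursAt x z c) (sym (++-assoc q w (concat ws))) (proj₁ Aqv)))

  split-at-boundary : ∀ ws {s c e} u v → Chain s e (u ++ v) ws → OccursAt x u s →
                      c ≡ s + length u → IsA x v c →
                      Σ (List (List S)) λ us → Σ (List (List S)) λ vs →
                      ChainOrEmpty s c u us × ChainOrEmpty c e v vs ×
                      length ws ≤ length us + length vs + 1
  split-at-boundary [] u v _ _ _ _ = [] , [] , inj₁ refl , inj₁ refl , z≤n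
  split-at-boundary (w ∷ ws) {s} u v (cat , w≢[] , Aw , cf) o c≡ Av
    with ++-≡-++-cases w (concat ws) u v cat
  ... | inj₁ (u′ , refl , cat′)
    with split-at-boundary ws u′ v (cat′ , cf) (proj₂ (occursAt-++⁻ w u′ s o))
                           (trans c≡ (+-length-++ s w u′)) Av
  ...   | us , vs , hu , hv , bound with absorb-prefix u′ us w≢[] Aw o c≡ hu
  ...     | us′ , us′-length , ch =
    us′ , vs , inj₂ ch , hv ,
    subst (λ n → suc (length ws) ≤ n + length vs + 1) (sym us′-length) (s≤s bound)
  split-at-boundary (w ∷ ws) {s} u v (cat , w≢[] , Aw , cf) o c≡ Av
    | inj₂ (q , q≢[] , refl , refl)
    with absorb-suffix q ws q≢[] Av (trans (+-length-++ s u q) (cong (_+ length q) (sym c≡))) cf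
  ... | vs , ws≤vs , ch =
    [] , vs , inj₁ refl , inj₂ ch , subst (suc (length ws) ≤_) (+-comm 1 (length vs)) (s≤s ws≤vs)

  IsA-++ : ∀ {u v a} → IsA x u a → IsA x v (a + length u) → IsA x (u ++ v) a
  IsA-++ {u} {v} {a} Au Av = IsA-++ʳ v Au (occursAt-++⁺ u v a (proj₁ Au) (proj₁ Av))

  IsL-++-lower : ∀ {u v a lu lv luv} → IsA x u a → IsA x v (a + length u) →
                 IsL x u lu → IsL x v lv → IsL x (u ++ v) luv → lu + lv ≤ luv
  IsL-++-lower _ _ (([] , (_ , () , _) , _) , _) _ _
  IsL-++-lower {u} {v} {a} {luv = luv} Au Av ((us@(_ ∷ _) , Cu , refl) , _) ((vs , Cv , refl) , _) (_ , maximal) =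
    subst (_≤ luv) (length-++ us) (maximal (us ++ vs) (Chain⇒Consecutive (IsA-++ Au Av) chain))
    where
    chain : Chain a (a + length (u ++ v)) (u ++ v) (us ++ vs)
    chain = subst (λ t → Chain a t (u ++ v) (us ++ vs)) (sym (+-length-++ a u v))
              (Chain-++ us vs (Consecutive⇒Chain Au Cu) (Consecutive⇒Chain Av Cv))

  IsL-++-upper : ∀ {u v a lu lv luv} → IsA x u a → IsA x v (a + length u) →
                 IsL x u lu → IsL x v lv → IsL x (u ++ v) luv → luv ≤ lu + lv + 1
  IsL-++-upper {u} {v} {a} Au Av Lu Lv ((ws , Cw , refl) , _)
    with split-at-boundary ws u v (Consecutive⇒Chain (IsA-++ Au Av) Cw) (proj₁ Au) refl Av
  ... | us , vs , hu , hv , bound =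
    ≤-trans bound (+-mono-≤ (+-mono-≤ (ChainOrEmpty-length≤L Au Lu hu)
                                       (ChainOrEmpty-length≤L Av Lv hv′)) ≤-refl)
    where
    hv′ : ChainOrEmpty (a + length u) (a + length u + length v) v vs
    hv′ = subst (λ t → ChainOrEmpty (a + length u) t v vs) (+-length-++ a u v) hv

proposition12 : {S : Set} (x : ℕ → S) → ¬ UltimatelyPeriodic x →
    (u v : List S) → Factor x u → Factor x v →
    (a : ℕ) → IsA x u a → IsA x v (a + length u) →
    (lu lv luv : ℕ) → IsL x u lu → IsL x v lv → IsL x (u ++ v) luv →
    (lu + lv ≤ luv) × (luv ≤ lu + lv + 1)
proposition12 x _ u v _ _ a Au Av lu lv luv Lu Lv Luv =
  IsL-++-lower x Au Av Lu Lv Luv , IsL-++-upper x Au Av Lu Lv Luv
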